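{- Let $\ell,n$ be positive integers and $p_1,\dots,p_\ell$ distinct primes. For each $i\in\{1,\dots,\ell\}$ let $\Psi_i$ be a transitive projective automorphism of $\mathbb{P}^n(\mathbb{F}_{p_i})$ and $\psi_i:\mathbb{F}_{p_i}^n\to\mathbb{F}_{p_i}^n$ its fractional jump. Let $N=p_1\cdots p_\ell$ and $R=\mathbb{Z}/N\mathbb{Z}$. Then there exists a transitive map $\psi:R^n\to R^n$ (i.e. a permutation of $R^n$ with a single orbit) such that for every $i\in\{1,\dots,\ell\}$, its reduction modulo $p_i$ is $\psi_i$, i.e. $\pi_i\circ\psi=\psi_i\circ\pi_i$ where $\pi_i:R^n\to\mathbb{F}_{p_i}^n$ is reduction modulo $p_i$.
   Context: For a prime $p$, a projective automorphism $\Psi\in\mathrm{PGL}_{n+1}(\mathbb{F}_p)$ is transitive if it has a single orbit on $\mathbb{P}^n(\mathbb{F}_p)$. With $U=\{[X_0:\dots:X_n]:X_n\neq0\}$ and $\pi(x_1,\dots,x_n)=[x_1:\dots:x_n:1]$, the fractional jump of $\Psi$ is $\psi(x)=\pi^{ -1}\Psi^{k}\pi(x)$ where $k=\min\{k\geq1:\Psi^k(\pi(x))\in U\}$. -}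

module Defs where

open import Data.Nat using (ℕ; zero; suc; _+_; _*_; _≤_; _<_; NonZero)
open import Data.Nat.DivMod using (_mod_)
open import Data.Fin using (Fin; toℕ; _≟_)
open import Data.Vec using (Vec; lookup; tabulate; map; last; _∷ʳ_)
open import Data.Product using (Σ; ∃; _×_)
open import Relation.Binary.PropositionalEquality using (_≡_; _≢_)
open import Relation.Nullary using (yes; no)
open import Function using (_∘_)

sumℕ : ∀ {ℓ} → (Fin ℓ → ℕ) → ℕ
sumℕ {zero} f = 0
sumℕ {suc ℓ} f = f Data.Fin.zero + sumℕ (f ∘ Data.Fin.suc)

prodℕ : ∀ {ℓ} → (Fin ℓ → ℕ) → ℕ
prodℕ {zero} f = 1
prodℕ {suc ℓ} f = f Data.Fin.zero * prodℕ (f ∘ Data.Fin.suc)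

iter : ∀ {A : Set} → ℕ → (A → A) → A → A
iter zero f x = x
iter (suc k) f x = f (iter k f x)

-- Arithmetic of ℤ/pℤ (= 𝔽_p when p is prime), elements represented by Fin p

module _ (p : ℕ) .{{_ : NonZero p}} where

  0F : Fin p
  0F = 0 mod p

  1F : Fin p
  1F = 1 mod p

  _+F_ : Fin p → Fin p → Fin p
  a +F b = (toℕ a + toℕ b) mod p

  _*F_ : Fin p → Fin p → Fin p
  a *F b = (toℕ a * toℕ b) mod p

  sumF : ∀ {m} → (Fin m → Fin p) → Fin p
  sumF {zero} f = 0F
  sumF {suc m} f = f Data.Fin.zero +F sumF (f ∘ Data.Fin.suc)

Mat : ℕ → ℕ → Set
Mat m p = Fin m → Fin m → Fin p

module _ {p : ℕ} .{{_ : NonZero p}} where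

  matMul : ∀ {m} → Mat m p → Mat m p → Mat m p
  matMul M M' i j = sumF p (λ l → _*F_ p (M i l) (M' l j))

  idMat : ∀ {m} → Mat m p
  idMat i j with i ≟ j
  ... | yes _ = 1F p
  ... | no _ = 0F p

  Invertible : ∀ {m} → Mat m p → Set
  Invertible M = Σ (Mat _ p) λ M' → ∀ i j → matMul M M' i j ≡ idMat i j

  mulVec : ∀ {m} → Mat m p → Vec (Fin p) m → Vec (Fin p) m
  mulVec M v = tabulate (λ i → sumF p (λ j → _*F_ p (M i j) (lookup v j)))

  act : ∀ {m} → Mat m p → ℕ → Vec (Fin p) m → Vec (Fin p) m
  act M k = iter k (mulVec M)

  -- nonzero vectors (representatives of points of projective space)
  NonZeroVec : ∀ {m} → Vec (Fin p) m → Set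
  NonZeroVec v = ∃ λ j → lookup v j ≢ 0F p

  _≈P_ : ∀ {m} → Vec (Fin p) m → Vec (Fin p) m → Set
  u ≈P v = ∃ λ c → (c ≢ 0F p) × (u ≡ map (_*F_ p c) v)

  TransitivePGL : ∀ {n} → Mat (suc n) p → Set
  TransitivePGL {n} M = (u v : Vec (Fin p) (suc n)) → NonZeroVec u → NonZeroVec v →
                        ∃ λ k → act M k u ≈P v

  πvec : ∀ {n} → Vec (Fin p) n → Vec (Fin p) (suc n)
  πvec x = x ∷ʳ 1F p

  InU : ∀ {n} → Vec (Fin p) (suc n) → Set
  InU v = last v ≢ 0F p

  -- ψ is the fractional jump of [M]: for every x, with k the least k ≥ 1
  -- such that Ψ^k(π x) ∈ U, we have π(ψ x) = Ψ^k(π x) in ℙ^n(𝔽_p),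
  -- i.e. ψ x = π⁻¹ Ψ^k π x.
  IsFracJump : ∀ {n} → Mat (suc n) p → (Vec (Fin p) n → Vec (Fin p) n) → Set
  IsFracJump M ψ = ∀ x → ∃ λ k →
      (1 ≤ k)
    × InU (act M k (πvec x))
    × (∀ j → 1 ≤ j → j < k → last (act M j (πvec x)) ≡ 0F p)
    × (πvec (ψ x) ≈P act M k (πvec x))

red : ∀ {N} (p : ℕ) .{{_ : NonZero p}} → Fin N → Fin p
red p a = toℕ a mod p

TransitiveMap : {A : Set} → (A → A) → Set
TransitiveMap {A} f = (∀ x y → f x ≡ f y → x ≡ y) × (∀ x y → ∃ λ k → iter k f x ≡ y)

{-# OPTIONS --safe #-}
module Submission where

-- Each fractional jump ψᵢ is a transitive permutation of 𝔽ₚᵢⁿ: its iterates visit, in order,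
-- the points of the single Ψᵢ-orbit that lie in U, so they reach every point of 𝔽ₚᵢⁿ.  A
-- transitive self-map of a set with s elements is one s-cycle, hence ψᵢ^(pᵢⁿ) = id.  Glue the
-- ψᵢ coordinatewise by the Chinese remainder theorem into ψ on (ℤ/N)ⁿ.  It is injective since
-- a point of (ℤ/N)ⁿ is determined by its reductions, and transitive since the iteration counts
-- needed in the factors can be realised by a single K, the cycle lengths pᵢⁿ being coprime.

open import Defs
open import Data.Nat using (ℕ; zero; suc; pred; _+_; _*_; _∸_; _^_; _%_; _/_; _≤_; _<_; _<?_; z≤n; s≤s;
  NonZero; >-nonZero; >-nonZero⁻¹; nonTrivial⇒≢1)
open import Data.Nat.Properties using (+-comm; +-suc; +-identityʳ; *-comm; *-assoc; *-identityˡ; *-identityʳ;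
  *-zeroʳ; *-distribˡ-+; *-distribʳ-∸; ≤-trans; ≤-<-trans; ≤-antisym; <⇒≤; ≮⇒≥; <-cmp; m≤m+n; +-monoʳ-<;
  m<1+n⇒m<n∨m≡n; m<n⇒0<n∸m; m∸n+n≡m; m∸n≤m; m∸n≡0⇒m≤n; ∸-monoʳ-<; [m+n]∸[m+o]≡n∸o; suc-pred; m*n≢0; m^n≢0)
open import Data.Nat.DivMod using (_mod_; m≡m%n+[m/n]*n; m%n<n; m<n⇒m%n≡m; %-distribˡ-+; %-distribˡ-*;
  [m+kn]%n≡m%n; m*n%n≡0; m∣n⇒o%n%m≡o%m)
open import Data.Nat.Divisibility using (_∣_; divides; ∣-trans; 1∣_; m∣m*n; n∣m*n; >⇒∤; m%n≡0⇒n∣m;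
  n∣m⇒m%n≡0; ∣1⇒≡1)
open import Data.Nat.Coprimality as Coprime using (Coprime; coprime-divisor; coprime-Bézout; coprime⇒gcd≡1;
  prime⇒coprime)
open import Data.Nat.GCD using (gcd; module Bézout)
open import Data.Nat.LCM using (lcm; lcm-least; gcd*lcm)
open import Data.Nat.Primality using (Prime; prime⇒nonZero; prime⇒nonTrivial; euclidsLemma)
open import Data.Nat.Induction using (<-rec)
open import Data.Fin using (Fin; toℕ) renaming (zero to fzero; suc to fsuc)
import Data.Fin.Properties as Fin
open import Data.Vec using (Vec; []; _∷_; uncons; map; tabulate; lookup; last)
open import Data.Vec.Properties using (map-∘; map-cong; map-id; map-∷ʳ; lookup-map; tabulate-cong; tabulate-∘;
  tabulate∘lookup; last-∷ʳ; ∷ʳ-injective)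
open import Data.Product using (Σ; ∃; _×_; _,_; proj₁; proj₂; uncurry)
open import Data.Product.Function.NonDependent.Propositional using (_×-↔_)
open import Data.Sum using (inj₁; inj₂)
open import Data.Empty using (⊥-elim)
open import Function using (_∘_; it; _↔_; Inverse; mk↔ₛ′; Injective)
open import Function.Properties.Inverse using (↔-refl; ↔-sym; ↔-trans)
open import Relation.Binary using (tri<; tri≈; tri>; DecidableEquality)
open import Relation.Nullary using (¬_; Dec; yes; no)
open import Relation.Nullary.Decidable using (map′; _×-dec_)
open import Relation.Binary.PropositionalEquality using (_≡_; _≢_; refl; sym; trans; cong; cong₂; subst;
  module ≡-Reasoning)

module _ {A : Set} (f : A → A) where

  iter-+ : ∀ a b x → iter (a + b) f x ≡ iter a f (iter b f x)
  iter-+ zero    b x = refl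
  iter-+ (suc a) b x = cong f (iter-+ a b x)

  iter-comm : ∀ k x → iter k f (f x) ≡ f (iter k f x)
  iter-comm k x = trans (sym (iter-+ k 1 x)) (cong (λ t → iter t f x) (+-comm k 1))

  iter-*-period : ∀ {d x} → iter d f x ≡ x → ∀ q → iter (q * d) f x ≡ x
  iter-*-period         fᵈx≡x zero    = refl
  iter-*-period {d} {x} fᵈx≡x (suc q) = begin
    iter (d + q * d) f x        ≡⟨ iter-+ d (q * d) x ⟩
    iter d f (iter (q * d) f x) ≡⟨ cong (iter d f) (iter-*-period fᵈx≡x q) ⟩
    iter d f x                  ≡⟨ fᵈx≡x ⟩
    x                           ∎
    where open ≡-Reasoning

  iter-%-period : ∀ {d x} .{{_ : NonZero d}} → iter d f x ≡ x → ∀ k → iter k f x ≡ iter (k % d) f x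
  iter-%-period {d} {x} fᵈx≡x k = begin
    iter k f x                            ≡⟨ cong (λ t → iter t f x) (m≡m%n+[m/n]*n k d) ⟩
    iter (k % d + k / d * d) f x          ≡⟨ iter-+ (k % d) (k / d * d) x ⟩
    iter (k % d) f (iter (k / d * d) f x) ≡⟨ cong (iter (k % d) f) (iter-*-period fᵈx≡x (k / d)) ⟩
    iter (k % d) f x                      ∎
    where open ≡-Reasoning

module _ {P : ℕ → Set} (P? : ∀ n → Dec (P n)) where

  Least : ℕ → Set
  Least d = P d × (∀ {e} → e < d → ¬ P e)

  least : ∀ {n} → P n → ∃ Least
  least {n} Pn = search n 0 (λ ()) (subst P (sym (+-identityʳ n)) Pn)
    where
    search : ∀ r i → (∀ {e} → e < i → ¬ P e) → P (r + i) → ∃ Least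
    search zero    i below Pi = i , Pi , below
    search (suc r) i below Pr+i with P? i
    ... | yes Pi = i , Pi , below
    ... | no ¬Pi = search r (suc i) below′ (subst P (sym (+-suc r i)) Pr+i)
      where
      below′ : ∀ {e} → e < suc i → ¬ P e
      below′ e<1+i with m<1+n⇒m<n∨m≡n e<1+i
      ... | inj₁ e<i  = below e<i
      ... | inj₂ refl = ¬Pi

Vec↔Fin^ : ∀ {m} n → Vec (Fin m) n ↔ Fin (m ^ n)
Vec↔Fin^ zero    = mk↔ₛ′ (λ _ → fzero) (λ _ → []) (λ { fzero → refl ; (fsuc ()) }) (λ { [] → refl })
Vec↔Fin^ (suc n) = ↔-trans (↔-trans ∷↔× (↔-refl ×-↔ Vec↔Fin^ n)) (↔-sym Fin.*↔×)
  where
  ∷↔× : ∀ {A : Set} {n} → Vec A (suc n) ↔ (A × Vec A n)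
  ∷↔× = mk↔ₛ′ uncons (uncurry _∷_) (λ _ → refl) (λ { (x ∷ xs) → refl })

module TransitiveOnFinite {A : Set} {s} (A↔Fin : A ↔ Fin s) (f : A → A)
                          (transitive : ∀ x y → ∃ λ k → iter k f x ≡ y) where
  open Inverse A↔Fin using (to; from; strictlyInverseˡ; strictlyInverseʳ)

  to-injective : ∀ {a b} → to a ≡ to b → a ≡ b
  to-injective {a} {b} eq = begin
    a           ≡⟨ strictlyInverseʳ a ⟨
    from (to a) ≡⟨ cong from eq ⟩
    from (to b) ≡⟨ strictlyInverseʳ b ⟩
    b           ∎
    where open ≡-Reasoning

  _≟_ : DecidableEquality A
  a ≟ b = map′ to-injective (cong to) (to a Fin.≟ to b)

  module MinimalPeriod (x : A) {d} .{{_ : NonZero d}} (fᵈx≡x : iter d f x ≡ x)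
                       (minimal : ∀ {e} → 0 < e → e < d → iter e f x ≢ x) where

    orbit : Fin d → A
    orbit j = iter (toℕ j) f x

    no-repeat : ∀ {a b} → a < b → b < d → iter a f x ≢ iter b f x
    no-repeat {a} {b} a<b b<d fᵃx≡fᵇx = minimal (≤-trans (m<n⇒0<n∸m b<d) (m≤m+n (d ∸ b) a)) e<d (begin
      iter (d ∸ b + a) f x        ≡⟨ iter-+ f (d ∸ b) a x ⟩
      iter (d ∸ b) f (iter a f x) ≡⟨ cong (iter (d ∸ b) f) fᵃx≡fᵇx ⟩
      iter (d ∸ b) f (iter b f x) ≡⟨ iter-+ f (d ∸ b) b x ⟨
      iter (d ∸ b + b) f x        ≡⟨ cong (λ t → iter t f x) (m∸n+n≡m (<⇒≤ b<d)) ⟩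
      iter d f x                  ≡⟨ fᵈx≡x ⟩
      x                           ∎)
      where
      open ≡-Reasoning
      e<d : d ∸ b + a < d
      e<d = subst (d ∸ b + a <_) (m∸n+n≡m (<⇒≤ b<d)) (+-monoʳ-< (d ∸ b) a<b)

    orbit-injective : Injective _≡_ _≡_ orbit
    orbit-injective {i} {j} eq with <-cmp (toℕ i) (toℕ j)
    ... | tri< i<j _ _ = ⊥-elim (no-repeat i<j (Fin.toℕ<n j) eq)
    ... | tri≈ _ i≡j _ = Fin.toℕ-injective i≡j
    ... | tri> _ _ j<i = ⊥-elim (no-repeat j<i (Fin.toℕ<n i) (sym eq))

    position : A → Fin d
    position y = proj₁ (transitive x y) mod d

    orbit-position : ∀ y → orbit (position y) ≡ y
    orbit-position y = begin
      iter (toℕ (k mod d)) f x ≡⟨ cong (λ t → iter t f x) (Fin.toℕ-fromℕ< (m%n<n k d)) ⟩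
      iter (k % d) f x         ≡⟨ iter-%-period f fᵈx≡x k ⟨
      iter k f x               ≡⟨ proj₂ (transitive x y) ⟩
      y                        ∎
      where
      open ≡-Reasoning
      k = proj₁ (transitive x y)

    position-from-injective : Injective _≡_ _≡_ (position ∘ from)
    position-from-injective {i} {j} eq = begin
      i                              ≡⟨ strictlyInverseˡ i ⟨
      to (from i)                    ≡⟨ cong to (orbit-position (from i)) ⟨
      to (orbit (position (from i))) ≡⟨ cong (to ∘ orbit) eq ⟩
      to (orbit (position (from j))) ≡⟨ cong to (orbit-position (from j)) ⟩
      to (from j)                    ≡⟨ strictlyInverseˡ j ⟩
      j                              ∎
      where open ≡-Reasoning

    period≡size : d ≡ s
    period≡size = ≤-antisym (Fin.injective⇒≤ (orbit-injective ∘ to-injective))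
                            (Fin.injective⇒≤ position-from-injective)

  iter-size≡id : ∀ x → iter s f x ≡ x
  iter-size≡id x with least returns? returns-eventually
    where
    returns : ℕ → Set
    returns e = 0 < e × iter e f x ≡ x
    returns? : ∀ e → Dec (returns e)
    returns? e = (0 <? e) ×-dec (iter e f x ≟ x)
    returns-eventually : returns (suc (proj₁ (transitive (f x) x)))
    returns-eventually = s≤s z≤n , trans (sym (iter-comm f k x)) (proj₂ (transitive (f x) x))
      where k = proj₁ (transitive (f x) x)
  ... | d , (0<d , fᵈx≡x) , below = subst (λ t → iter t f x ≡ x) period≡size fᵈx≡x
    where
    instance _ = >-nonZero 0<d
    open MinimalPeriod x fᵈx≡x (λ 0<e e<d fᵉx≡x → below e<d (0<e , fᵉx≡x))

  injective : ∀ {a b} → f a ≡ f b → a ≡ b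
  injective {a} {b} fa≡fb = begin
    a                     ≡⟨ iter-size≡id a ⟨
    iter s f a            ≡⟨ unfold a ⟩
    iter (pred s) f (f a) ≡⟨ cong (iter (pred s) f) fa≡fb ⟩
    iter (pred s) f (f b) ≡⟨ unfold b ⟨
    iter s f b            ≡⟨ iter-size≡id b ⟩
    b                     ∎
    where
    open ≡-Reasoning
    instance _ = Fin.nonZeroIndex (to a)
    unfold : ∀ z → iter s f z ≡ iter (pred s) f (f z)
    unfold z = trans (cong (λ t → iter t f z) (sym (suc-pred s))) (sym (iter-comm f (pred s) z))

0%n≡0 : ∀ n .{{_ : NonZero n}} → 0 % n ≡ 0
0%n≡0 n = m<n⇒m%n≡m (>-nonZero⁻¹ n)

module ModularArithmetic (p : ℕ) .{{_ : NonZero p}} where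

  infixl 7 _*ₚ_ _·_
  infixl 6 _+ₚ_

  _+ₚ_ _*ₚ_ : Fin p → Fin p → Fin p
  _+ₚ_ = _+F_ p
  _*ₚ_ = _*F_ p

  0ₚ 1ₚ : Fin p
  0ₚ = 0F p
  1ₚ = 1F p

  toℕ-mod : ∀ m → toℕ (m mod p) ≡ m % p
  toℕ-mod m = Fin.toℕ-fromℕ< (m%n<n m p)

  %≡%⇒mod≡mod : ∀ {m n} → m % p ≡ n % p → m mod p ≡ n mod p
  %≡%⇒mod≡mod {m} {n} eq = Fin.toℕ-injective (trans (toℕ-mod m) (trans eq (sym (toℕ-mod n))))

  mod≡mod⇒%≡% : ∀ {m n} → m mod p ≡ n mod p → m % p ≡ n % p
  mod≡mod⇒%≡% {m} {n} eq = trans (sym (toℕ-mod m)) (trans (cong toℕ eq) (toℕ-mod n))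

  toℕ-mod-id : ∀ (a : Fin p) → toℕ a mod p ≡ a
  toℕ-mod-id a = Fin.toℕ-injective (trans (toℕ-mod (toℕ a)) (m<n⇒m%n≡m (Fin.toℕ<n a)))

  mod-+ : ∀ m n → (m mod p) +ₚ (n mod p) ≡ (m + n) mod p
  mod-+ m n = %≡%⇒mod≡mod (begin
    (toℕ (m mod p) + toℕ (n mod p)) % p ≡⟨ cong₂ (λ a b → (a + b) % p) (toℕ-mod m) (toℕ-mod n) ⟩
    (m % p + n % p) % p                 ≡⟨ %-distribˡ-+ m n p ⟨
    (m + n) % p                         ∎)
    where open ≡-Reasoning

  mod-* : ∀ m n → (m mod p) *ₚ (n mod p) ≡ (m * n) mod p
  mod-* m n = %≡%⇒mod≡mod (begin
    (toℕ (m mod p) * toℕ (n mod p)) % p ≡⟨ cong₂ (λ a b → (a * b) % p) (toℕ-mod m) (toℕ-mod n) ⟩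
    (m % p * (n % p)) % p               ≡⟨ %-distribˡ-* m n p ⟨
    (m * n) % p                         ∎)
    where open ≡-Reasoning

  *ₚ-comm : ∀ a b → a *ₚ b ≡ b *ₚ a
  *ₚ-comm a b = cong (_mod p) (*-comm (toℕ a) (toℕ b))

  *ₚ-assoc : ∀ a b c → a *ₚ b *ₚ c ≡ a *ₚ (b *ₚ c)
  *ₚ-assoc a b c = begin
    a *ₚ b *ₚ c                              ≡⟨ cong (a *ₚ b *ₚ_) (toℕ-mod-id c) ⟨
    ((toℕ a * toℕ b) mod p) *ₚ (toℕ c mod p) ≡⟨ mod-* (toℕ a * toℕ b) (toℕ c) ⟩
    (toℕ a * toℕ b * toℕ c) mod p            ≡⟨ cong (_mod p) (*-assoc (toℕ a) (toℕ b) (toℕ c)) ⟩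
    (toℕ a * (toℕ b * toℕ c)) mod p          ≡⟨ mod-* (toℕ a) (toℕ b * toℕ c) ⟨
    (toℕ a mod p) *ₚ ((toℕ b * toℕ c) mod p) ≡⟨ cong (_*ₚ (b *ₚ c)) (toℕ-mod-id a) ⟩
    a *ₚ (b *ₚ c)                            ∎
    where open ≡-Reasoning

  *ₚ-distribˡ-+ₚ : ∀ c a b → c *ₚ (a +ₚ b) ≡ c *ₚ a +ₚ c *ₚ b
  *ₚ-distribˡ-+ₚ c a b = begin
    c *ₚ (a +ₚ b)                            ≡⟨ cong (_*ₚ (a +ₚ b)) (toℕ-mod-id c) ⟨
    (toℕ c mod p) *ₚ ((toℕ a + toℕ b) mod p) ≡⟨ mod-* (toℕ c) (toℕ a + toℕ b) ⟩
    (toℕ c * (toℕ a + toℕ b)) mod p          ≡⟨ cong (_mod p) (*-distribˡ-+ (toℕ c) (toℕ a) (toℕ b)) ⟩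
    (toℕ c * toℕ a + toℕ c * toℕ b) mod p    ≡⟨ mod-+ (toℕ c * toℕ a) (toℕ c * toℕ b) ⟨
    c *ₚ a +ₚ c *ₚ b                         ∎
    where open ≡-Reasoning

  *ₚ-zeroʳ : ∀ c → c *ₚ 0ₚ ≡ 0ₚ
  *ₚ-zeroʳ c = begin
    c *ₚ 0ₚ                    ≡⟨ cong (_*ₚ 0ₚ) (toℕ-mod-id c) ⟨
    (toℕ c mod p) *ₚ (0 mod p) ≡⟨ mod-* (toℕ c) 0 ⟩
    (toℕ c * 0) mod p          ≡⟨ cong (_mod p) (*-zeroʳ (toℕ c)) ⟩
    0ₚ                         ∎
    where open ≡-Reasoning

  *ₚ-identityʳ : ∀ c → c *ₚ 1ₚ ≡ c
  *ₚ-identityʳ c = begin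
    c *ₚ 1ₚ                    ≡⟨ cong (_*ₚ 1ₚ) (toℕ-mod-id c) ⟨
    (toℕ c mod p) *ₚ (1 mod p) ≡⟨ mod-* (toℕ c) 1 ⟩
    (toℕ c * 1) mod p          ≡⟨ cong (_mod p) (*-identityʳ (toℕ c)) ⟩
    toℕ c mod p                ≡⟨ toℕ-mod-id c ⟩
    c                          ∎
    where open ≡-Reasoning

  *ₚ-identityˡ : ∀ c → 1ₚ *ₚ c ≡ c
  *ₚ-identityˡ c = trans (*ₚ-comm 1ₚ c) (*ₚ-identityʳ c)

  sumF-cong : ∀ {m} {f g : Fin m → Fin p} → (∀ j → f j ≡ g j) → sumF p f ≡ sumF p g
  sumF-cong {zero}  f≗g = refl
  sumF-cong {suc m} f≗g = cong₂ _+ₚ_ (f≗g fzero) (sumF-cong (f≗g ∘ fsuc))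

  *ₚ-distribˡ-sumF : ∀ {m} c (f : Fin m → Fin p) → c *ₚ sumF p f ≡ sumF p (λ j → c *ₚ f j)
  *ₚ-distribˡ-sumF {zero}  c f = *ₚ-zeroʳ c
  *ₚ-distribˡ-sumF {suc m} c f =
    trans (*ₚ-distribˡ-+ₚ c _ _) (cong (c *ₚ f fzero +ₚ_) (*ₚ-distribˡ-sumF c (f ∘ fsuc)))

  _·_ : ∀ {m} → Fin p → Vec (Fin p) m → Vec (Fin p) m
  c · v = map (c *ₚ_) v

  ·-assoc : ∀ {m} c d (v : Vec (Fin p) m) → c · (d · v) ≡ (c *ₚ d) · v
  ·-assoc c d v = trans (sym (map-∘ (c *ₚ_) (d *ₚ_) v)) (map-cong (λ x → sym (*ₚ-assoc c d x)) v)

  ·-identity : ∀ {m} (v : Vec (Fin p) m) → 1ₚ · v ≡ v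
  ·-identity v = trans (map-cong *ₚ-identityˡ v) (map-id v)

  last-· : ∀ {m} c (v : Vec (Fin p) (suc m)) → last (c · v) ≡ c *ₚ last v
  last-· c (x ∷ [])     = refl
  last-· c (x ∷ y ∷ ys) = last-· c (y ∷ ys)

  mulVec-· : ∀ {m} (M : Mat m p) c v → mulVec M (c · v) ≡ c · mulVec M v
  mulVec-· M c v = begin
    tabulate (λ i → sumF p (λ j → M i j *ₚ lookup (c · v) j)) ≡⟨ tabulate-cong entry ⟩
    tabulate (λ i → c *ₚ sumF p (λ j → M i j *ₚ lookup v j))  ≡⟨ tabulate-∘ (c *ₚ_) _ ⟩
    c · mulVec M v                                            ∎
    where
    open ≡-Reasoning
    term : ∀ i j → M i j *ₚ lookup (c · v) j ≡ c *ₚ (M i j *ₚ lookup v j)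
    term i j = begin
      M i j *ₚ lookup (c · v) j  ≡⟨ cong (M i j *ₚ_) (lookup-map j (c *ₚ_) v) ⟩
      M i j *ₚ (c *ₚ lookup v j) ≡⟨ *ₚ-assoc (M i j) c (lookup v j) ⟨
      M i j *ₚ c *ₚ lookup v j   ≡⟨ cong (_*ₚ lookup v j) (*ₚ-comm (M i j) c) ⟩
      c *ₚ M i j *ₚ lookup v j   ≡⟨ *ₚ-assoc c (M i j) (lookup v j) ⟩
      c *ₚ (M i j *ₚ lookup v j) ∎
    entry : ∀ i → sumF p (λ j → M i j *ₚ lookup (c · v) j) ≡ c *ₚ sumF p (λ j → M i j *ₚ lookup v j)
    entry i = trans (sumF-cong (term i)) (sym (*ₚ-distribˡ-sumF c (λ j → M i j *ₚ lookup v j)))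

  act-· : ∀ {m} (M : Mat m p) k c v → act M k (c · v) ≡ c · act M k v
  act-· M zero    c v = refl
  act-· M (suc k) c v = trans (cong (mulVec M) (act-· M k c v)) (mulVec-· M c (act M k v))

module ProjectiveSpace (p : ℕ) (prime : Prime p) where

  instance
    p≢0 : NonZero p
    p≢0 = prime⇒nonZero prime

  open ModularArithmetic p

  mod≡0ₚ⇒∣ : ∀ {m} → m mod p ≡ 0ₚ → p ∣ m
  mod≡0ₚ⇒∣ {m} eq = m%n≡0⇒n∣m m p (trans (mod≡mod⇒%≡% eq) (0%n≡0 p))

  ∣⇒≡0ₚ : ∀ {a} → p ∣ toℕ a → a ≡ 0ₚ
  ∣⇒≡0ₚ {a} p∣a = trans (sym (toℕ-mod-id a)) (%≡%⇒mod≡mod (trans (n∣m⇒m%n≡0 (toℕ a) p p∣a) (sym (0%n≡0 p))))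

  1ₚ≢0ₚ : 1ₚ ≢ 0ₚ
  1ₚ≢0ₚ eq = nonTrivial⇒≢1 {{prime⇒nonTrivial prime}} (∣1⇒≡1 (mod≡0ₚ⇒∣ eq))

  *ₚ-nonzero : ∀ {a b} → a ≢ 0ₚ → b ≢ 0ₚ → a *ₚ b ≢ 0ₚ
  *ₚ-nonzero {a} {b} a≢0 b≢0 ab≡0 with euclidsLemma (toℕ a) (toℕ b) prime (mod≡0ₚ⇒∣ ab≡0)
  ... | inj₁ p∣a = a≢0 (∣⇒≡0ₚ p∣a)
  ... | inj₂ p∣b = b≢0 (∣⇒≡0ₚ p∣b)

  module _ {m : ℕ} where

    ≈P-refl : ∀ {v : Vec (Fin p) m} → v ≈P v
    ≈P-refl {v} = 1ₚ , 1ₚ≢0ₚ , sym (·-identity v)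

    ≈P-trans : ∀ {u v w : Vec (Fin p) m} → u ≈P v → v ≈P w → u ≈P w
    ≈P-trans (c , c≢0 , refl) (d , d≢0 , refl) = c *ₚ d , *ₚ-nonzero c≢0 d≢0 , ·-assoc c d _

    act-resp-≈P : ∀ (M : Mat m p) k {u v} → u ≈P v → act M k u ≈P act M k v
    act-resp-≈P M k (c , c≢0 , refl) = c , c≢0 , act-· M k c _

  InU-resp-≈P : ∀ {m} {u v : Vec (Fin p) (suc m)} → u ≈P v → InU v → InU u
  InU-resp-≈P {v = v} (c , c≢0 , refl) v∈U = *ₚ-nonzero c≢0 v∈U ∘ trans (sym (last-· c v))

  πvec∈U : ∀ {n} (x : Vec (Fin p) n) → InU (πvec x)
  πvec∈U x = 1ₚ≢0ₚ ∘ trans (sym (last-∷ʳ 1ₚ x))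

  πvec-nonZero : ∀ {n} (x : Vec (Fin p) n) → NonZeroVec (πvec x)
  πvec-nonZero []      = fzero , 1ₚ≢0ₚ
  πvec-nonZero (a ∷ x) with πvec-nonZero x
  ... | j , xⱼ≢0 = fsuc j , xⱼ≢0

  πvec-≈P-injective : ∀ {n} {x y : Vec (Fin p) n} → πvec x ≈P πvec y → x ≡ y
  πvec-≈P-injective {x = x} {y} (c , _ , πx≡c·πy) = begin
    x      ≡⟨ proj₁ parts ⟩
    c · y  ≡⟨ cong (_· y) c≡1 ⟩
    1ₚ · y ≡⟨ ·-identity y ⟩
    y      ∎
    where
    open ≡-Reasoning
    parts : x ≡ c · y × 1ₚ ≡ c *ₚ 1ₚ
    parts = ∷ʳ-injective x (c · y) (trans πx≡c·πy (map-∷ʳ (c *ₚ_) 1ₚ y))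
    c≡1 : c ≡ 1ₚ
    c≡1 = sym (trans (proj₂ parts) (*ₚ-identityʳ c))

module FractionalJump (p : ℕ) (prime : Prime p) {n} (M : Mat (suc n) p)
                      (ψ : Vec (Fin p) n → Vec (Fin p) n)
                      (jump : IsFracJump {{prime⇒nonZero prime}} M ψ) where

  open ProjectiveSpace p prime

  ReachedBy-ψ : ℕ → Set
  ReachedBy-ψ k = ∀ x → InU (act M k (πvec x)) → ∃ λ m → πvec (iter m ψ x) ≈P act M k (πvec x)

  -- π (ψ x) is the first point after π x on its Ψ-orbit that lies in U, so every later point
  -- of that orbit in U is π of an iterate of ψ.
  reachedBy-ψ : ∀ k → ReachedBy-ψ k
  reachedBy-ψ = <-rec ReachedBy-ψ step
    where
    step : ∀ k → (∀ {j} → j < k → ReachedBy-ψ j) → ReachedBy-ψ k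
    step zero      _   x _ = 0 , ≈P-refl
    step k@(suc _) rec x Ψᵏπx∈U with jump x
    ... | j , 0<j , _ , skipped , πψx≈Ψʲπx with k <? j
    ...   | yes k<j = ⊥-elim (Ψᵏπx∈U (skipped k (s≤s z≤n) k<j))
    ...   | no  k≮j = suc m , ≈P-trans πψᵐ⁺¹x≈Ψʳπψx Ψʳπψx≈Ψᵏπx
      where
      j≤k = ≮⇒≥ k≮j
      r = k ∸ j
      Ψʳ∘Ψʲ≡Ψᵏ : act M r (act M j (πvec x)) ≡ act M k (πvec x)
      Ψʳ∘Ψʲ≡Ψᵏ = trans (sym (iter-+ (mulVec M) r j (πvec x))) (cong (λ t → act M t (πvec x)) (m∸n+n≡m j≤k))
      Ψʳπψx≈Ψᵏπx : act M r (πvec (ψ x)) ≈P act M k (πvec x)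
      Ψʳπψx≈Ψᵏπx = subst (act M r (πvec (ψ x)) ≈P_) Ψʳ∘Ψʲ≡Ψᵏ (act-resp-≈P M r πψx≈Ψʲπx)
      IH = rec (∸-monoʳ-< 0<j j≤k) (ψ x) (InU-resp-≈P Ψʳπψx≈Ψᵏπx Ψᵏπx∈U)
      m = proj₁ IH
      πψᵐ⁺¹x≈Ψʳπψx : πvec (iter (suc m) ψ x) ≈P act M r (πvec (ψ x))
      πψᵐ⁺¹x≈Ψʳπψx = subst (_≈P _) (cong πvec (iter-comm ψ m x)) (proj₂ IH)

  transitive : TransitivePGL {{prime⇒nonZero prime}} M → ∀ x y → ∃ λ m → iter m ψ x ≡ y
  transitive Ψ-transitive x y with Ψ-transitive (πvec x) (πvec y) (πvec-nonZero x) (πvec-nonZero y)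
  ... | k , Ψᵏπx≈πy with reachedBy-ψ k x (InU-resp-≈P Ψᵏπx≈πy (πvec∈U y))
  ...   | m , πψᵐx≈Ψᵏπx = m , πvec-≈P-injective (≈P-trans πψᵐx≈Ψᵏπx Ψᵏπx≈πy)

module _ {d : ℕ} .{{_ : NonZero d}} where

  *-%-congʳ : ∀ x {e f} → e % d ≡ f % d → (x * e) % d ≡ (x * f) % d
  *-%-congʳ x {e} {f} eq = begin
    (x * e) % d           ≡⟨ %-distribˡ-* x e d ⟩
    (x % d * (e % d)) % d ≡⟨ cong (λ t → (x % d * t) % d) eq ⟩
    (x % d * (f % d)) % d ≡⟨ %-distribˡ-* x f d ⟨
    (x * f) % d           ∎
    where open ≡-Reasoning

  +-%-cong : ∀ {u u′ v v′} → u % d ≡ u′ % d → v % d ≡ v′ % d → (u + v) % d ≡ (u′ + v′) % d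
  +-%-cong {u} {u′} {v} {v′} eq₁ eq₂ = begin
    (u + v) % d           ≡⟨ %-distribˡ-+ u v d ⟩
    (u % d + v % d) % d   ≡⟨ cong₂ (λ s t → (s + t) % d) eq₁ eq₂ ⟩
    (u′ % d + v′ % d) % d ≡⟨ %-distribˡ-+ u′ v′ d ⟨
    (u′ + v′) % d         ∎
    where open ≡-Reasoning

  %≡%⇒∣∸ : ∀ a b → a % d ≡ b % d → d ∣ a ∸ b
  %≡%⇒∣∸ a b eq = divides (a / d ∸ b / d) (begin
    a ∸ b                                     ≡⟨ cong₂ _∸_ (m≡m%n+[m/n]*n a d) (m≡m%n+[m/n]*n b d) ⟩
    (a % d + a / d * d) ∸ (b % d + b / d * d) ≡⟨ cong (λ t → (a % d + a / d * d) ∸ (t + b / d * d)) eq ⟨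
    (a % d + a / d * d) ∸ (a % d + b / d * d) ≡⟨ [m+n]∸[m+o]≡n∸o (a % d) (a / d * d) (b / d * d) ⟩
    a / d * d ∸ b / d * d                     ≡⟨ *-distribʳ-∸ d (a / d) (b / d) ⟨
    (a / d ∸ b / d) * d                       ∎)
    where open ≡-Reasoning

∣∧<⇒≡0 : ∀ {d x} → d ∣ x → x < d → x ≡ 0
∣∧<⇒≡0 {x = zero}  _   _   = refl
∣∧<⇒≡0 {x = suc x} d∣x x<d = ⊥-elim (>⇒∤ x<d d∣x)

coprime-* : ∀ {a b c} → Coprime a b → Coprime a c → Coprime a (b * c)
coprime-* {a} {b} {c} a⊥b a⊥c {d} (d∣a , d∣bc) = a⊥c (d∣a , coprime-divisor d⊥b d∣bc)
  where
  d⊥b : Coprime d b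
  d⊥b (e∣d , e∣b) = a⊥b (∣-trans e∣d d∣a , e∣b)

coprime-^ : ∀ {a b} → Coprime a b → ∀ n → Coprime a (b ^ n)
coprime-^ a⊥b zero    (_ , d∣1) = ∣1⇒≡1 d∣1
coprime-^ a⊥b (suc n) = coprime-* a⊥b (coprime-^ a⊥b n)

coprime-^-^ : ∀ {a b} → Coprime a b → ∀ n → Coprime (a ^ n) (b ^ n)
coprime-^-^ a⊥b n = Coprime.sym (coprime-^ (Coprime.sym (coprime-^ a⊥b n)) n)

coprime⇒*∣ : ∀ {a b c} → Coprime a b → a ∣ c → b ∣ c → a * b ∣ c
coprime⇒*∣ {a} {b} a⊥b a∣c b∣c = subst (_∣ _) lcm≡* (lcm-least a∣c b∣c)
  where
  lcm≡* : lcm a b ≡ a * b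
  lcm≡* = begin
    lcm a b           ≡⟨ *-identityˡ (lcm a b) ⟨
    1 * lcm a b       ≡⟨ cong (_* lcm a b) (coprime⇒gcd≡1 a⊥b) ⟨
    gcd a b * lcm a b ≡⟨ gcd*lcm a b ⟩
    a * b             ∎
    where open ≡-Reasoning

distinct-primes-coprime : ∀ {p q} → Prime p → Prime q → p ≢ q → Coprime p q
distinct-primes-coprime {p} {q} p-prime q-prime p≢q with <-cmp p q
... | tri< p<q _ _ = Coprime.sym (prime⇒coprime q-prime {{prime⇒nonZero p-prime}} p<q)
... | tri≈ _ p≡q _ = ⊥-elim (p≢q p≡q)
... | tri> _ _ q<p = prime⇒coprime p-prime {{prime⇒nonZero q-prime}} q<p

crt-unit : ∀ {a b} .{{_ : NonZero a}} .{{_ : NonZero b}} → Coprime a b →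
           ∃ λ e → e % a ≡ 1 % a × e % b ≡ 0 % b
-- Bézout gives 1 + ua = vb, or 1 + vb = ua and then (a ∸ 1)·vb ≡ −vb ≡ 1 (mod a).
crt-unit {a} {b} a⊥b with coprime-Bézout a⊥b
... | Bézout.-+ u v 1+ua≡vb =
  v * b , trans (cong (_% a) (sym 1+ua≡vb)) ([m+kn]%n≡m%n 1 u a) , trans (m*n%n≡0 v b) (sym (0%n≡0 b))
... | Bézout.+- u v 1+vb≡ua = e , e%a , trans e%b (sym (0%n≡0 b))
  where
  e = (a ∸ 1) * (v * b)
  e%b : e % b ≡ 0
  e%b = trans (cong (_% b) (sym (*-assoc (a ∸ 1) v b))) (m*n%n≡0 ((a ∸ 1) * v) b)
  shift : e + u * a ≡ 1 + v * b * a
  shift = begin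
    e + u * a                 ≡⟨ cong (e +_) 1+vb≡ua ⟨
    e + (1 + v * b)           ≡⟨ +-comm e (1 + v * b) ⟩
    1 + (v * b + e)           ≡⟨⟩
    1 + suc (a ∸ 1) * (v * b) ≡⟨ cong (λ t → 1 + t * (v * b)) (suc-pred a) ⟩
    1 + a * (v * b)           ≡⟨ cong (1 +_) (*-comm a (v * b)) ⟩
    1 + v * b * a             ∎
    where open ≡-Reasoning
  e%a : e % a ≡ 1 % a
  e%a = trans (sym ([m+kn]%n≡m%n e u a)) (trans (cong (_% a) shift) ([m+kn]%n≡m%n 1 (v * b) a))

crt₂ : ∀ {a b} .{{_ : NonZero a}} .{{_ : NonZero b}} → Coprime a b →
       ∀ x y → ∃ λ k → k % a ≡ x % a × k % b ≡ y % b
crt₂ {a} {b} a⊥b x y with crt-unit a⊥b | crt-unit (Coprime.sym a⊥b)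
... | e₁ , e₁≡1[a] , e₁≡0[b] | e₂ , e₂≡1[b] , e₂≡0[a] =
  x * e₁ + y * e₂ ,
  trans (+-%-cong (*-%-congʳ x e₁≡1[a]) (*-%-congʳ y e₂≡0[a])) (cong (_% a) x*1+y*0≡x) ,
  trans (+-%-cong (*-%-congʳ x e₁≡0[b]) (*-%-congʳ y e₂≡1[b])) (cong (_% b) x*0+y*1≡y)
  where
  x*1+y*0≡x : x * 1 + y * 0 ≡ x
  x*1+y*0≡x = trans (cong₂ _+_ (*-identityʳ x) (*-zeroʳ y)) (+-identityʳ x)
  x*0+y*1≡y : x * 0 + y * 1 ≡ y
  x*0+y*1≡y = trans (cong (_+ y * 1) (*-zeroʳ x)) (*-identityʳ y)

PairwiseCoprime : ∀ {ℓ} → (Fin ℓ → ℕ) → Set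
PairwiseCoprime m = ∀ i j → i ≢ j → Coprime (m i) (m j)

module _ {ℓ : ℕ} where

  pairwiseCoprime-tail : {m : Fin (suc ℓ) → ℕ} → PairwiseCoprime m → PairwiseCoprime (m ∘ fsuc)
  pairwiseCoprime-tail coprime i j i≢j = coprime (fsuc i) (fsuc j) (i≢j ∘ Fin.suc-injective)

  pairwiseCoprime-^ : {m : Fin ℓ → ℕ} → PairwiseCoprime m → ∀ n → PairwiseCoprime (λ i → m i ^ n)
  pairwiseCoprime-^ coprime n i j i≢j = coprime-^-^ (coprime i j i≢j) n

prodℕ-nonZero : ∀ {ℓ} (m : Fin ℓ → ℕ) .{{_ : ∀ {i} → NonZero (m i)}} → NonZero (prodℕ m)
prodℕ-nonZero {zero}  m = _
prodℕ-nonZero {suc ℓ} m = m*n≢0 (m fzero) (prodℕ (m ∘ fsuc))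
  where instance _ = prodℕ-nonZero (m ∘ fsuc)

∣-prodℕ : ∀ {ℓ} (m : Fin ℓ → ℕ) i → m i ∣ prodℕ m
∣-prodℕ m fzero    = m∣m*n (prodℕ (m ∘ fsuc))
∣-prodℕ m (fsuc i) = ∣-trans (∣-prodℕ (m ∘ fsuc) i) (n∣m*n (m fzero))

coprime-prodℕ : ∀ {ℓ a} (m : Fin ℓ → ℕ) → (∀ i → Coprime a (m i)) → Coprime a (prodℕ m)
coprime-prodℕ {zero}  m _   (_ , d∣1) = ∣1⇒≡1 d∣1
coprime-prodℕ {suc ℓ} m a⊥m = coprime-* (a⊥m fzero) (coprime-prodℕ (m ∘ fsuc) (a⊥m ∘ fsuc))

coprime-head-tail : ∀ {ℓ} {m : Fin (suc ℓ) → ℕ} → PairwiseCoprime m → Coprime (m fzero) (prodℕ (m ∘ fsuc))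
coprime-head-tail {m = m} coprime = coprime-prodℕ (m ∘ fsuc) (λ i → coprime fzero (fsuc i) λ ())

prodℕ-∣ : ∀ {ℓ} {m : Fin ℓ → ℕ} {c} → PairwiseCoprime m → (∀ i → m i ∣ c) → prodℕ m ∣ c
prodℕ-∣ {zero}  _       _   = 1∣ _
prodℕ-∣ {suc ℓ} coprime m∣c =
  coprime⇒*∣ (coprime-head-tail coprime) (m∣c fzero) (prodℕ-∣ (pairwiseCoprime-tail coprime) (m∣c ∘ fsuc))

module _ {ℓ} (m : Fin ℓ → ℕ) .{{_ : ∀ {i} → NonZero (m i)}} where

  crt-unique : PairwiseCoprime m → ∀ {a b} → a < prodℕ m → b < prodℕ m →
               (∀ i → a % m i ≡ b % m i) → a ≡ b
  crt-unique coprime a<N b<N a≡b = ≤-antisym (≤-half a<N a≡b) (≤-half b<N (sym ∘ a≡b))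
    where
    ≤-half : ∀ {a b} → a < prodℕ m → (∀ i → a % m i ≡ b % m i) → a ≤ b
    ≤-half {a} {b} a<N a≡b = m∸n≡0⇒m≤n (∣∧<⇒≡0 (prodℕ-∣ coprime (λ i → %≡%⇒∣∸ a b (a≡b i)))
                                               (≤-<-trans (m∸n≤m a b) a<N))

crt : ∀ {ℓ} (m : Fin ℓ → ℕ) .{{_ : ∀ {i} → NonZero (m i)}} → PairwiseCoprime m →
      (r : Fin ℓ → ℕ) → ∃ λ k → ∀ i → k % m i ≡ r i % m i
crt {zero}  m coprime r = 0 , λ ()
crt {suc ℓ} m coprime r
  with k′ , k′≡r ← crt (m ∘ fsuc) (pairwiseCoprime-tail coprime) (r ∘ fsuc)
  with k , k≡r₀ , k≡k′ ← crt₂ {{it}} {{prodℕ-nonZero (m ∘ fsuc)}} (coprime-head-tail coprime) (r fzero) k′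
  = k , k≡r
  where
  instance _ = prodℕ-nonZero (m ∘ fsuc)
  k≡r : ∀ i → k % m i ≡ r i % m i
  k≡r fzero    = k≡r₀
  k≡r (fsuc i) = begin
    k % m (fsuc i)                     ≡⟨ via-tail k ⟨
    k % prodℕ (m ∘ fsuc) % m (fsuc i)  ≡⟨ cong (_% m (fsuc i)) k≡k′ ⟩
    k′ % prodℕ (m ∘ fsuc) % m (fsuc i) ≡⟨ via-tail k′ ⟩
    k′ % m (fsuc i)                    ≡⟨ k′≡r i ⟩
    r (fsuc i) % m (fsuc i)            ∎
    where
    open ≡-Reasoning
    via-tail : ∀ t → t % prodℕ (m ∘ fsuc) % m (fsuc i) ≡ t % m (fsuc i)
    via-tail t = m∣n⇒o%n%m≡o%m (m (fsuc i)) (prodℕ (m ∘ fsuc)) t (∣-prodℕ (m ∘ fsuc) i)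

module ChineseRemainderLift {ℓ} (m : Fin ℓ → ℕ) .{{_ : ∀ {i} → NonZero (m i)}}
                            (coprime : PairwiseCoprime m) where

  instance
    N≢0 : NonZero (prodℕ m)
    N≢0 = prodℕ-nonZero m

  lift : ((i : Fin ℓ) → Fin (m i)) → Fin (prodℕ m)
  lift v = proj₁ (crt m coprime (toℕ ∘ v)) mod prodℕ m

  red-lift : ∀ v i → red (m i) (lift v) ≡ v i
  red-lift v i = trans (%≡%⇒mod≡mod (begin
    toℕ (k mod prodℕ m) % m i ≡⟨ cong (_% m i) (ModularArithmetic.toℕ-mod (prodℕ m) k) ⟩
    k % prodℕ m % m i         ≡⟨ m∣n⇒o%n%m≡o%m (m i) (prodℕ m) k (∣-prodℕ m i) ⟩
    k % m i                   ≡⟨ proj₂ (crt m coprime (toℕ ∘ v)) i ⟩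
    toℕ (v i) % m i           ∎)) (toℕ-mod-id (v i))
    where
    open ≡-Reasoning
    open ModularArithmetic (m i)
    k = proj₁ (crt m coprime (toℕ ∘ v))

  red-injective : ∀ {a b} → (∀ i → red (m i) a ≡ red (m i) b) → a ≡ b
  red-injective {a} {b} a≡b = Fin.toℕ-injective
    (crt-unique m coprime (Fin.toℕ<n a) (Fin.toℕ<n b) (λ i → ModularArithmetic.mod≡mod⇒%≡% (m i) (a≡b i)))

  module _ {n : ℕ} where

    liftVec : ((i : Fin ℓ) → Vec (Fin (m i)) n) → Vec (Fin (prodℕ m)) n
    liftVec vs = tabulate (λ c → lift (λ i → lookup (vs i) c))

    red-liftVec : ∀ vs i → map (red (m i)) (liftVec vs) ≡ vs i
    red-liftVec vs i = begin
      map (red (m i)) (liftVec vs)                              ≡⟨ tabulate-∘ (red (m i)) _ ⟨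
      tabulate (λ c → red (m i) (lift (λ j → lookup (vs j) c))) ≡⟨ tabulate-cong (λ c → red-lift _ i) ⟩
      tabulate (lookup (vs i))                                  ≡⟨ tabulate∘lookup (vs i) ⟩
      vs i                                                      ∎
      where open ≡-Reasoning

    red-injectiveVec : ∀ {x y : Vec (Fin (prodℕ m)) n} →
                       (∀ i → map (red (m i)) x ≡ map (red (m i)) y) → x ≡ y
    red-injectiveVec {x} {y} x≡y = begin
      x                   ≡⟨ tabulate∘lookup x ⟨
      tabulate (lookup x) ≡⟨ tabulate-cong (λ c → red-injective (entry c)) ⟩
      tabulate (lookup y) ≡⟨ tabulate∘lookup y ⟩
      y                   ∎
      where
      open ≡-Reasoning
      entry : ∀ c i → red (m i) (lookup x c) ≡ red (m i) (lookup y c)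
      entry c i = begin
        red (m i) (lookup x c)       ≡⟨ lookup-map c (red (m i)) x ⟨
        lookup (map (red (m i)) x) c ≡⟨ cong (λ v → lookup v c) (x≡y i) ⟩
        lookup (map (red (m i)) y) c ≡⟨ lookup-map c (red (m i)) y ⟩
        red (m i) (lookup y c)       ∎

module ChineseRemainderGluing {ℓ n} (m : Fin ℓ → ℕ) .{{_ : ∀ {i} → NonZero (m i)}} (coprime : PairwiseCoprime m)
                             (ψs : (i : Fin ℓ) → Vec (Fin (m i)) n → Vec (Fin (m i)) n)
                             (transitive : ∀ i x y → ∃ λ k → iter k (ψs i) x ≡ y) where

  open ChineseRemainderLift m coprime

  ψ : Vec (Fin (prodℕ m)) n → Vec (Fin (prodℕ m)) n
  ψ x = liftVec (λ i → ψs i (map (red (m i)) x))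

  red-ψ : ∀ i x → map (red (m i)) (ψ x) ≡ ψs i (map (red (m i)) x)
  red-ψ i x = red-liftVec (λ j → ψs j (map (red (m j)) x)) i

  red-iter-ψ : ∀ i k x → map (red (m i)) (iter k ψ x) ≡ iter k (ψs i) (map (red (m i)) x)
  red-iter-ψ i zero    x = refl
  red-iter-ψ i (suc k) x = trans (red-ψ i (iter k ψ x)) (cong (ψs i) (red-iter-ψ i k x))

  module Component (i : Fin ℓ) = TransitiveOnFinite (Vec↔Fin^ n) (ψs i) (transitive i)

  ψ-injective : ∀ x y → ψ x ≡ ψ y → x ≡ y
  ψ-injective x y ψx≡ψy = red-injectiveVec λ i → Component.injective i (begin
    ψs i (map (red (m i)) x) ≡⟨ red-ψ i x ⟨
    map (red (m i)) (ψ x)    ≡⟨ cong (map (red (m i))) ψx≡ψy ⟩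
    map (red (m i)) (ψ y)    ≡⟨ red-ψ i y ⟩
    ψs i (map (red (m i)) y) ∎)
    where open ≡-Reasoning

  ψ-transitive : ∀ x y → ∃ λ k → iter k ψ x ≡ y
  ψ-transitive x y = K , red-injectiveVec λ i → trans (red-iter-ψ i K x) (component i)
    where
    instance _ = λ {i} → m^n≢0 (m i) n
    xᵢ yᵢ : ∀ i → Vec (Fin (m i)) n
    xᵢ i = map (red (m i)) x
    yᵢ i = map (red (m i)) y
    kᵢ : Fin ℓ → ℕ
    kᵢ i = proj₁ (transitive i (xᵢ i) (yᵢ i))
    joint = crt (λ i → m i ^ n) (pairwiseCoprime-^ coprime n) kᵢ
    K = proj₁ joint
    component : ∀ i → iter K (ψs i) (xᵢ i) ≡ yᵢ i
    component i = begin
      iter K (ψs i) (xᵢ i)                ≡⟨ period K ⟩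
      iter (K % m i ^ n) (ψs i) (xᵢ i)    ≡⟨ cong (λ t → iter t (ψs i) (xᵢ i)) (proj₂ joint i) ⟩
      iter (kᵢ i % m i ^ n) (ψs i) (xᵢ i) ≡⟨ period (kᵢ i) ⟨
      iter (kᵢ i) (ψs i) (xᵢ i)           ≡⟨ proj₂ (transitive i (xᵢ i) (yᵢ i)) ⟩
      yᵢ i                                ∎
      where
      open ≡-Reasoning
      period : ∀ k → iter k (ψs i) (xᵢ i) ≡ iter (k % m i ^ n) (ψs i) (xᵢ i)
      period = iter-%-period (ψs i) {d = m i ^ n} (Component.iter-size≡id i (xᵢ i))

  ψ-transitiveMap : TransitiveMap ψ
  ψ-transitiveMap = ψ-injective , ψ-transitive

mainTheorem7 : (ℓ n : ℕ) → 1 ≤ ℓ → 1 ≤ n →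
    (p : Fin ℓ → ℕ) → (pr : ∀ i → Prime (p i)) →
    (∀ i j → p i ≡ p j → i ≡ j) →
    (M : (i : Fin ℓ) → Mat (suc n) (p i)) →
    (∀ i → Invertible {{prime⇒nonZero (pr i)}} (M i)) →
    (∀ i → TransitivePGL {{prime⇒nonZero (pr i)}} (M i)) →
    (ψs : (i : Fin ℓ) → Vec (Fin (p i)) n → Vec (Fin (p i)) n) →
    (∀ i → IsFracJump {{prime⇒nonZero (pr i)}} (M i) (ψs i)) →
    Σ (Vec (Fin (prodℕ p)) n → Vec (Fin (prodℕ p)) n) λ ψ →
      TransitiveMap ψ
      × (∀ i x → map (red (p i) {{prime⇒nonZero (pr i)}}) (ψ x)
                 ≡ ψs i (map (red (p i) {{prime⇒nonZero (pr i)}}) x))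
mainTheorem7 ℓ n _ _ p prime distinct M _ Ψ-transitive ψs jump = ψ , ψ-transitiveMap , red-ψ
  where
  instance _ = λ {i} → prime⇒nonZero (prime i)
  coprime : PairwiseCoprime p
  coprime i j i≢j = distinct-primes-coprime (prime i) (prime j) (i≢j ∘ distinct i j)
  ψᵢ-transitive : ∀ i x y → ∃ λ k → iter k (ψs i) x ≡ y
  ψᵢ-transitive i = FractionalJump.transitive (p i) (prime i) (M i) (ψs i) (jump i) (Ψ-transitive i)
  open ChineseRemainderGluing p coprime ψs ψᵢ-transitive
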